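{- Let $G$ be a graph with $V(G)=\{0\}\cup A\cup B$, $A=\{1,\dots,p\}$, $B=\{p+1,\dots,p+q\}$, $p,q\ge1$, such that $\mathcal{PF}(G)$ is invariant under the action of $\mathfrak{S}_p\times\mathfrak{S}_q$. Then for $S=A$ and for $S=B$, $deg_G(i)=deg_G(i')$ for all $i,i'\in\mathcal{I}(G)\cap S$.
   Context: A graph is a finite, connected, undirected, loopless multigraph with root $0$, viewed as a simple graph with edge-weight function $wt$ counting parallel edges; $deg_G(i)=\sum_j wt(\{i,j\})$ is the weighted degree. For $U\subseteq V(G)$ and $i\in U$, $d_U(i)=\sum_{j\notin U}wt(\{i,j\})$. A $G$-parking function is $(b_1,\dots,b_{p+q})\in\mathbb{N}^{p+q}$ such that every non-empty $U\subseteq A\cup B$ contains $i$ with $b_i<d_U(i)$; $\mathcal{PF}(G)$ is their set. Writing such a sequence as $(\mathbf a,\mathbf b)$ with $\mathbf a=(b_1,\dots,b_p)$, $\mathbf b=(b_{p+1},\dots,b_{p+q})$, $\mathfrak{S}_p\times\mathfrak{S}_q$ acts by permuting entries of $\mathbf a$ and of $\mathbf b$ separately; invariance means closure under this action. A cut vertex is a vertex whose deletion disconnects $G$. $\mathcal{I}(G)$ is the set of vertices in $A\cup B$ that are not cut vertices of $G$. -}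

module Defs where

open import Data.Nat using (ℕ; zero; suc; _+_; _<_; _≤_)
open import Data.Fin using (Fin; zero; suc; splitAt; _↑ˡ_; _↑ʳ_)
open import Data.Fin.Subset using (Subset; Nonempty; _∈_; _∉_)
open import Data.Fin.Permutation using (Permutation′; _⟨$⟩ʳ_)
open import Data.Vec using (lookup)
open import Data.Bool using (Bool; true; false; if_then_else_)
open import Data.Sum using ([_,_]′)
open import Data.Product using (Σ; ∃; _×_)
open import Data.Unit using (⊤)
open import Relation.Binary.PropositionalEquality using (_≡_; _≢_)
open import Relation.Nullary using (¬_)

sumFin : ∀ {m} → (Fin m → ℕ) → ℕ
sumFin {zero}  f = 0
sumFin {suc m} f = f zero + sumFin (λ j → f (suc j))

data WalkIn {N : ℕ} (wt : Fin N → Fin N → ℕ) (ok : Fin N → Set) : Fin N → Fin N → Set where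
  here : ∀ {u} → ok u → WalkIn wt ok u u
  step : ∀ {u w v} → ok u → 0 < wt u w → WalkIn wt ok w v → WalkIn wt ok u v

-- A graph on vertex set {0} ∪ {1,…,n}; vertex 0 is zero, vertex k+1 is suc k.
-- Finite, connected, undirected, loopless multigraph given by edge multiplicities.
record Graph (n : ℕ) : Set where
  field
    wt        : Fin (suc n) → Fin (suc n) → ℕ
    wt-sym    : ∀ i j → wt i j ≡ wt j i
    loopless  : ∀ i → wt i i ≡ 0
    connected : ∀ u v → WalkIn wt (λ _ → ⊤) u v
open Graph public

deg : ∀ {n} → Graph n → Fin (suc n) → ℕ
deg G i = sumFin (wt G i)

inU : ∀ {n} → Subset n → Fin (suc n) → Bool
inU U zero    = false
inU U (suc k) = lookup U k

-- d_U(i) = Σ_{j ∉ U} wt({i,j}),  i ∈ {1,…,n} given as i : Fin n (vertex suc i)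
dU : ∀ {n} → Graph n → Subset n → Fin n → ℕ
dU G U i = sumFin (λ j → if inU U j then 0 else wt G (suc i) j)

-- G-parking functions (b_1,…,b_n), with b_{k+1} = b k
IsPF : ∀ {n} → Graph n → (Fin n → ℕ) → Set
IsPF {n} G b = (U : Subset n) → Nonempty U → ∃ λ i → i ∈ U × b i < dU G U i

-- action of (σ,τ) ∈ S_p × S_q on positions of A ∪ B = Fin (p + q)
act : ∀ {p q} → Permutation′ p → Permutation′ q → Fin (p + q) → Fin (p + q)
act {p} {q} σ τ i = [ (λ x → (σ ⟨$⟩ʳ x) ↑ˡ q) , (λ y → p ↑ʳ (τ ⟨$⟩ʳ y)) ]′ (splitAt p i)

PFInvariant : ∀ p q → Graph (p + q) → Set
PFInvariant p q G = ∀ (σ : Permutation′ p) (τ : Permutation′ q) (b : Fin (p + q) → ℕ) →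
  IsPF G b → IsPF G (λ i → b (act σ τ i))

IsCutVertex : ∀ {n} → Graph n → Fin (suc n) → Set
IsCutVertex G v = Σ _ λ u → Σ _ λ w →
  u ≢ v × w ≢ v × ¬ WalkIn (wt G) (λ x → x ≢ v) u w

InI : ∀ {n} → Graph n → Fin n → Set
InI G k = ¬ IsCutVertex G (suc k)

{-# OPTIONS --safe #-}
-- For a non-cut vertex i, the sequence that is deg(i) − 1 at i and 0 elsewhere is a
-- G-parking function: a set U ∋ i that contains some other vertex j meets the walk from
-- j to the root avoiding i, and the vertex of U where that walk first leaves U has
-- positive d_U; a set U ⊆ {i} has d_U(i) = deg(i).  Transporting this sequence by the
-- transposition of i and i′ and testing it on U = {i′} gives deg(i) − 1 < deg(i′).
module Submission where

open import Defs
open import Data.Nat using (ℕ; zero; suc; _+_; _≤_; _<_; pred; z≤n)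
open import Data.Nat.Properties using (≤-refl; ≤-trans; ≤-antisym; m≤m+n; m≤n+m; +-mono-≤; n<1+n; _<?_)
open import Data.Fin using (Fin; zero; suc; _↑ˡ_; _↑ʳ_; _≟_)
open import Data.Fin.Properties using (any?; splitAt-↑ˡ; splitAt-↑ʳ; suc-injective)
open import Data.Fin.Subset using (_∈_; ⁅_⁆)
open import Data.Fin.Subset.Properties using (_∈?_; x∈⁅x⁆; x∈⁅y⁆⇒x≡y)
open import Data.Fin.Permutation using (transpose; id)
import Data.Fin.Permutation.Components as PC
open import Data.Vec using (lookup)
open import Data.Vec.Properties using (lookup⇒[]=; []=⇒lookup)
open import Data.Bool using (true; false; if_then_else_)
open import Data.Product using (_×_; _,_; ∃)
open import Data.Empty using (⊥-elim)
open import Function using (_∘_)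
open import Relation.Nullary using (¬_; yes; no; does)
open import Relation.Nullary.Decidable using (dec-true; dec-false; decidable-stable; ¬?; _×-dec_)
open import Relation.Binary.PropositionalEquality using (_≡_; _≢_; refl; sym; trans; cong; cong₂; subst)

sumFin-≥ : ∀ {m} (f : Fin m → ℕ) k → f k ≤ sumFin f
sumFin-≥ f zero    = m≤m+n _ _
sumFin-≥ f (suc k) = ≤-trans (sumFin-≥ (f ∘ suc) k) (m≤n+m _ (f zero))

sumFin-mono-≤ : ∀ {m} {f g : Fin m → ℕ} → (∀ k → f k ≤ g k) → sumFin f ≤ sumFin g
sumFin-mono-≤ {zero}  f≤g = z≤n
sumFin-mono-≤ {suc m} f≤g = +-mono-≤ (f≤g zero) (sumFin-mono-≤ (f≤g ∘ suc))

sumFin-cong : ∀ {m} {f g : Fin m → ℕ} → (∀ k → f k ≡ g k) → sumFin f ≡ sumFin g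
sumFin-cong {zero}  f≗g = refl
sumFin-cong {suc m} f≗g = cong₂ _+_ (f≗g zero) (sumFin-cong (f≗g ∘ suc))

pred<⇒≤ : ∀ {m n} → pred m < n → m ≤ n
pred<⇒≤ {zero}  _ = z≤n
pred<⇒≤ {suc m} h = h

pred[n]<n : ∀ {n} → 0 < n → pred n < n
pred[n]<n {suc n} _ = n<1+n n

if-then-0-≤ : ∀ b x → (if b then 0 else x) ≤ x
if-then-0-≤ true  x = z≤n
if-then-0-≤ false x = ≤-refl

transpose-matchˡ : ∀ {n} (i j : Fin n) → PC.transpose i j i ≡ j
transpose-matchˡ i j rewrite dec-true (i ≟ i) refl = refl

single : ∀ {n} → Fin n → ℕ → Fin n → ℕ
single i v k = if does (k ≟ i) then v else 0

single-≡ : ∀ {n} (i : Fin n) v → single i v i ≡ v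
single-≡ i v rewrite dec-true (i ≟ i) refl = refl

single-≢ : ∀ {n} {i k : Fin n} v → k ≢ i → single i v k ≡ 0
single-≢ {i = i} {k} v k≢i rewrite dec-false (k ≟ i) k≢i = refl

module _ {n : ℕ} (G : Graph n) where

  dU≤deg : ∀ U k → dU G U k ≤ deg G (suc k)
  dU≤deg U k = sumFin-mono-≤ (λ j → if-then-0-≤ (inU U j) (wt G (suc k) j))

  wt≤dU : ∀ U k w → inU U w ≡ false → wt G (suc k) w ≤ dU G U k
  wt≤dU U k w w∉U =
    subst (_≤ dU G U k) (cong (λ b → if b then 0 else wt G (suc k) w) w∉U)
      (sumFin-≥ (λ j → if inU U j then 0 else wt G (suc k) j) w)

  dU≡deg : ∀ U i → (∀ j → j ∈ U → j ≡ i) → dU G U i ≡ deg G (suc i)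
  dU≡deg U i U⊆⁅i⁆ = sumFin-cong term≡wt
    where
    term≡wt : ∀ j → (if inU U j then 0 else wt G (suc i) j) ≡ wt G (suc i) j
    term≡wt zero = refl
    term≡wt (suc k) with lookup U k in k∈U
    ... | false = refl
    ... | true with U⊆⁅i⁆ k (lookup⇒[]= k U k∈U)
    ...   | refl = sym (loopless G (suc i))

  deg-pos : ∀ i → 0 < deg G (suc i)
  deg-pos i with connected G (suc i) zero
  ... | step {w = w} _ 0<wt _ = ≤-trans 0<wt (sumFin-≥ (wt G (suc i)) w)

  walk-exit : ∀ U {ok : Fin (suc n) → Set} {u v} → WalkIn (wt G) ok u v →
              inU U u ≡ true → inU U v ≡ false →
              ∃ λ k → k ∈ U × ok (suc k) × 0 < dU G U k
  walk-exit U (here _) u∈U v∉U with () ← trans (sym u∈U) v∉U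
  walk-exit U {u = suc k} (step {w = w} ok-u 0<wt W) u∈U v∉U with inU U w in w∈U
  ... | true  = walk-exit U W w∈U v∉U
  ... | false = k , lookup⇒[]= k U u∈U , ok-u , ≤-trans 0<wt (wt≤dU U k w w∈U)

  nonCut⇒¬¬exit : ∀ {U i j} → InI G i → j ∈ U → j ≢ i →
                  ¬ ¬ (∃ λ k → k ∈ U × k ≢ i × 0 < dU G U k)
  nonCut⇒¬¬exit {U} {i} {j} nonCut j∈U j≢i noExit =
    nonCut (suc j , zero , j≢i ∘ suc-injective , (λ ()) , noWalk)
    where
    noWalk : ¬ WalkIn (wt G) (_≢ suc i) (suc j) zero
    noWalk W with walk-exit U W ([]=⇒lookup j∈U) refl
    ... | k , k∈U , sk≢si , 0<dU = noExit (k , k∈U , sk≢si ∘ cong suc , 0<dU)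

  -- Non-cut-ness is a negative hypothesis, so the witness is found by a decidable search.
  single-isPF : ∀ i v → InI G i → v < deg G (suc i) → IsPF G (single i v)
  single-isPF i v nonCut v<deg U nonempty =
    decidable-stable (any? (λ k → (k ∈? U) ×-dec (single i v k <? dU G U k))) notNot
    where
    notNot : ¬ ¬ (∃ λ k → k ∈ U × single i v k < dU G U k)
    notNot noWitness with any? (λ j → (j ∈? U) ×-dec ¬? (j ≟ i))
    ... | yes (j , j∈U , j≢i) = nonCut⇒¬¬exit nonCut j∈U j≢i λ (k , k∈U , k≢i , 0<dU) →
          noWitness (k , k∈U , subst (_< dU G U k) (sym (single-≢ v k≢i)) 0<dU)
    ... | no onlyI = noWitness (i , i∈U , v<dU)
      where
      U⊆⁅i⁆ : ∀ j → j ∈ U → j ≡ i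
      U⊆⁅i⁆ j j∈U with j ≟ i
      ... | yes j≡i = j≡i
      ... | no j≢i  = ⊥-elim (onlyI (j , j∈U , j≢i))

      i∈U : i ∈ U
      i∈U = let (j , j∈U) = nonempty in subst (_∈ U) (U⊆⁅i⁆ j j∈U) j∈U

      v<dU : single i v i < dU G U i
      v<dU rewrite single-≡ i v | dU≡deg U i U⊆⁅i⁆ = v<deg

  invariant⇒deg≤ : (π : Fin n → Fin n) → (∀ b → IsPF G b → IsPF G (b ∘ π)) →
                   ∀ {i i′} → π i′ ≡ i → InI G i → deg G (suc i) ≤ deg G (suc i′)
  invariant⇒deg≤ π invariant {i} {i′} πi′≡i nonCut =
    pred<⇒≤ (≤-trans δ<dU (dU≤deg ⁅ i′ ⁆ i′))
    where
    δ : ℕ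
    δ = pred (deg G (suc i))

    witness : ∃ λ k → k ∈ ⁅ i′ ⁆ × single i δ (π k) < dU G ⁅ i′ ⁆ k
    witness = invariant (single i δ) (single-isPF i δ nonCut (pred[n]<n (deg-pos i)))
                ⁅ i′ ⁆ (i′ , x∈⁅x⁆ i′)

    δ<dU : δ < dU G ⁅ i′ ⁆ i′
    δ<dU with witness
    ... | k , k∈⁅i′⁆ , b<dU with x∈⁅y⁆⇒x≡y i′ k∈⁅i′⁆
    ...   | refl = subst (_< dU G ⁅ i′ ⁆ i′) (trans (cong (single i δ) πi′≡i) (single-≡ i δ)) b<dU

lemma6p3 : (p q : ℕ) → 1 ≤ p → 1 ≤ q → (G : Graph (p + q)) → PFInvariant p q G →
    ((x x′ : Fin p) → InI G (x ↑ˡ q) → InI G (x′ ↑ˡ q) →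
      deg G (suc (x ↑ˡ q)) ≡ deg G (suc (x′ ↑ˡ q)))
    × ((y y′ : Fin q) → InI G (p ↑ʳ y) → InI G (p ↑ʳ y′) →
      deg G (suc (p ↑ʳ y)) ≡ deg G (suc (p ↑ʳ y′)))
lemma6p3 p q _ _ G invariant =
  (λ x x′ nx nx′ → ≤-antisym (degA≤ x x′ nx) (degA≤ x′ x nx′)) ,
  (λ y y′ ny ny′ → ≤-antisym (degB≤ y y′ ny) (degB≤ y′ y ny′))
  where
  degA≤ : ∀ x x′ → InI G (x ↑ˡ q) → deg G (suc (x ↑ˡ q)) ≤ deg G (suc (x′ ↑ˡ q))
  degA≤ x x′ = invariant⇒deg≤ G _ (invariant (transpose x′ x) id) swaps
    where
    swaps : act (transpose x′ x) id (x′ ↑ˡ q) ≡ x ↑ˡ q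
    swaps rewrite splitAt-↑ˡ p x′ q = cong (_↑ˡ q) (transpose-matchˡ x′ x)

  degB≤ : ∀ y y′ → InI G (p ↑ʳ y) → deg G (suc (p ↑ʳ y)) ≤ deg G (suc (p ↑ʳ y′))
  degB≤ y y′ = invariant⇒deg≤ G _ (invariant id (transpose y′ y)) swaps
    where
    swaps : act {p} id (transpose y′ y) (p ↑ʳ y′) ≡ p ↑ʳ y
    swaps rewrite splitAt-↑ʳ p q y′ = cong (p ↑ʳ_) (transpose-matchˡ y′ y)
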